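{- Let $n,p>0$ be integers and let $A=A^{p+1}_{n+1}$, $\le$ and $\odot$ be as in the context. For all $a,b,c\in A$, if $b\le c$ then $a\odot b\le a\odot c$.
   Context: Fix integers $n,p>0$. On $\mathbb{Z}\times\mathbb{Z}$ use componentwise addition/subtraction and the lexicographic total order $\preccurlyeq$: $(m,r)\preccurlyeq(k,s)$ iff $m<k$, or $m=k$ and $r\le s$; $\max,\min$ are taken with respect to $\preccurlyeq$. For an integer $j\ge 0$ let $L^\omega_{j+1}=\{(m,r)\in\mathbb{Z}^2:(0,0)\preccurlyeq(m,r)\preccurlyeq(j,0)\}$. On $L^\omega_{n+1}$ put $x*y=\max\{(0,0),x+y-(n,0)\}$ and $x\to y=\min\{(n,0),(n,0)-x+y\}$. Let $L_{p+1}=\{0,1,\dots,p\}$ with the usual order and $\alpha*\beta=\max\{0,\alpha+\beta-p\}$. Let $A=A^{p+1}_{n+1}=(L^\omega_{n+1}\times\{0,p\})\cup(L^\omega_{n}\times\{1,\dots,p-1\})$, with elements written $\langle(m,r),\alpha\rangle$. Define $\langle(m,r),\alpha\rangle\le\langle(k,s),\beta\rangle$ iff either (o1) $0<\alpha\le\beta$ and $(m,r)\preccurlyeq(k,s)$; or (o2) $\alpha=\beta=0$ and $(k,s)\preccurlyeq(m,r)$; or (o3) $\alpha=0<\beta$ and $(n-1,0)\preccurlyeq(m+k,r+s)$. Define the commutative operation $\odot$ on $A$, for $a=\langle(m,r),\alpha\rangle$, $b=\langle(k,s),\beta\rangle$: (i) if $\alpha,\beta>0$ and $\alpha*\beta\neq0$: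 $a\odot b=\langle(m,r)*(k,s),\alpha*\beta\rangle$; (ii) if $\alpha,\beta>0$ and $\alpha*\beta=0$: $a\odot b=\langle\min\{(n,0),(2n-(m+k+1),-(r+s))\},0\rangle$; (iii) if $\alpha>0$, $\beta=0$: $a\odot b=\langle(m,r)\to(k,s),0\rangle$ (and symmetrically $b\odot a=a\odot b$); (iv) if $\alpha=\beta=0$: $a\odot b=\langle\min\{(n,0),(m+k+1,r+s)\},0\rangle$. -}

module Defs where

open import Data.Nat as ℕ using (ℕ; zero; suc; _∸_)
open import Data.Integer as ℤ using (ℤ; +_; _+_; _-_; -_)
open import Data.Product using (_×_; _,_)
open import Data.Sum using (_⊎_)
open import Relation.Nullary using (Dec; yes; no; ¬_)
open import Relation.Nullary.Decidable using (_⊎-dec_; _×-dec_)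
open import Relation.Binary.PropositionalEquality using (_≡_)

Pt : Set
Pt = ℤ × ℤ

_⊕_ : Pt → Pt → Pt
(m , r) ⊕ (k , s) = (m + k , r + s)

_⊖_ : Pt → Pt → Pt
(m , r) ⊖ (k , s) = (m - k , r - s)

_≼_ : Pt → Pt → Set
(m , r) ≼ (k , s) = (m ℤ.< k) ⊎ ((m ≡ k) × (r ℤ.≤ s))

_≼?_ : (x y : Pt) → Dec (x ≼ y)
(m , r) ≼? (k , s) = (m ℤ.<? k) ⊎-dec ((m ℤ.≟ k) ×-dec (r ℤ.≤? s))

maxL : Pt → Pt → Pt
maxL x y with x ≼? y
... | yes _ = y
... | no _  = x

minL : Pt → Pt → Pt
minL x y with x ≼? y
... | yes _ = x
... | no _  = y

-- membership in L^ω_{j+1} = {x : (0,0) ≼ x ≼ (j,0)}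
InLω : ℤ → Pt → Set
InLω j x = ((+ 0 , + 0) ≼ x) × (x ≼ (j , + 0))

module _ (n p : ℕ) where

  N0 : Pt
  N0 = (+ n , + 0)

  _*ω_ : Pt → Pt → Pt
  x *ω y = maxL (+ 0 , + 0) ((x ⊕ y) ⊖ N0)

  _→ω_ : Pt → Pt → Pt
  x →ω y = minL N0 ((N0 ⊖ x) ⊕ y)

  -- α * β = max{0, α + β - p} on L_{p+1}  (truncated subtraction in ℕ)
  _*p_ : ℕ → ℕ → ℕ
  α *p β = (α ℕ.+ β) ∸ p

  Elem : Set
  Elem = Pt × ℕ

  InA : Elem → Set
  InA (x , α) =
      (((α ≡ 0) ⊎ (α ≡ p)) × InLω (+ n) x)
    ⊎ (((0 ℕ.< α) × (α ℕ.< p)) × InLω (+ n - + 1) x)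

  _≤A_ : Elem → Elem → Set
  ((m , r) , α) ≤A ((k , s) , β) =
      ((0 ℕ.< α) × (α ℕ.≤ β) × ((m , r) ≼ (k , s)))
    ⊎ ((α ≡ 0) × (β ≡ 0) × ((k , s) ≼ (m , r)))
    ⊎ ((α ≡ 0) × (0 ℕ.< β) × ((+ n - + 1 , + 0) ≼ (m + k , r + s)))

  ⊙pos : Pt → Pt → ℕ → Elem
  ⊙pos (m , r) (k , s) zero =
    (minL N0 (+ 2 ℤ.* + n - (m + k + + 1) , - (r + s)) , 0)
  ⊙pos x y (suc g) = (x *ω y , suc g)

  _⊙_ : Elem → Elem → Elem
  (x , suc a) ⊙ (y , suc b) = ⊙pos x y (suc a *p suc b)
  (x , suc a) ⊙ (y , zero)  = (x →ω y , 0)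
  (x , zero)  ⊙ (y , suc b) = (y →ω x , 0)
  ((m , r) , zero) ⊙ ((k , s) , zero) = (minL N0 (m + k + + 1 , r + s) , 0)

-- In every case the unclamped points of a ⊙ b and a ⊙ c differ by ±(c − b), or, under
-- clause (o3) of b ≤ c, by b + c − (n−1,0); since the lexicographic order depends only on
-- differences, monotonicity of the clamps minL (n,0) and maxL (0,0) does the rest. Where
-- a ⊙ b ≤ a ⊙ c falls under clause (o3), its sum condition survives the clamps because
-- (n−1,0) ≼ (n,0) + (0,0).
module Submission where

open import Defs
open import Data.Nat as ℕ using (ℕ; _<_; zero; suc; z≤n; s≤s)
import Data.Nat.Properties as ℕP
open import Data.Integer as ℤ using (ℤ; +_; -_; _+_; _-_)
import Data.Integer.Properties as ℤP
open import Data.Product using (_,_)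
open import Data.Sum using (inj₁; inj₂)
open import Data.Empty using (⊥-elim)
open import Relation.Nullary using (¬_; yes; no)
open import Relation.Binary.Definitions using (tri<; tri≈; tri>)
open import Relation.Binary.PropositionalEquality
  using (_≡_; refl; sym; cong; cong₂; subst₂; module ≡-Reasoning)
open import Data.Integer.Tactic.RingSolver using (solve-∀)

≼-refl : ∀ x → x ≼ x
≼-refl (m , r) = inj₂ (refl , ℤP.≤-refl)

≼-trans : ∀ {x y z} → x ≼ y → y ≼ z → x ≼ z
≼-trans (inj₁ m<k)          (inj₁ k<l)          = inj₁ (ℤP.<-trans m<k k<l)
≼-trans (inj₁ m<k)          (inj₂ (refl , _))   = inj₁ m<k
≼-trans (inj₂ (refl , _))   (inj₁ k<l)          = inj₁ k<l
≼-trans (inj₂ (refl , r≤s)) (inj₂ (refl , s≤t)) = inj₂ (refl , ℤP.≤-trans r≤s s≤t)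

⋠⇒≽ : ∀ x y → ¬ (x ≼ y) → y ≼ x
⋠⇒≽ (m , r) (k , s) x⋠y with ℤP.<-cmp m k
... | tri< m<k _ _ = ⊥-elim (x⋠y (inj₁ m<k))
... | tri> _ _ k<m = inj₁ k<m
... | tri≈ _ refl _ with ℤP.≤-total s r
...   | inj₁ s≤r = inj₂ (refl , s≤r)
...   | inj₂ r≤s = ⊥-elim (x⋠y (inj₂ (refl , r≤s)))

≼-translate : ∀ d {x y} → x ≼ y → (x ⊕ d) ≼ (y ⊕ d)
≼-translate (d₁ , d₂) (inj₁ m<k)          = inj₁ (ℤP.+-monoˡ-< d₁ m<k)
≼-translate (d₁ , d₂) (inj₂ (refl , r≤s)) = inj₂ (refl , ℤP.+-monoˡ-≤ d₂ r≤s)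

⊕-monoʳ-≼ : ∀ u {x y} → x ≼ y → (u ⊕ x) ≼ (u ⊕ y)
⊕-monoʳ-≼ (u₁ , u₂) (inj₁ m<k)          = inj₁ (ℤP.+-monoʳ-< u₁ m<k)
⊕-monoʳ-≼ (u₁ , u₂) (inj₂ (refl , r≤s)) = inj₂ (refl , ℤP.+-monoʳ-≤ u₂ r≤s)

⊖-monoˡ-≼ : ∀ u {x y} → x ≼ y → (x ⊖ u) ≼ (y ⊖ u)
⊖-monoˡ-≼ (u₁ , u₂) = ≼-translate (- u₁ , - u₂)

⊖-antiʳ-≼ : ∀ u {x y} → x ≼ y → (u ⊖ y) ≼ (u ⊖ x)
⊖-antiʳ-≼ (u₁ , u₂) (inj₁ m<k)          = inj₁ (ℤP.+-monoʳ-< u₁ (ℤP.neg-mono-< m<k))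
⊖-antiʳ-≼ (u₁ , u₂) (inj₂ (refl , r≤s)) = inj₂ (refl , ℤP.+-monoʳ-≤ u₂ (ℤP.neg-mono-≤ r≤s))

x⊕[y⊖x]≡y : ∀ x y → x ⊕ (y ⊖ x) ≡ y
x⊕[y⊖x]≡y (a , b) (c , d) = cong₂ _,_ (i+[j-i]≡j a c) (i+[j-i]≡j b d)
  where
  i+[j-i]≡j : ∀ i j → i + (j - i) ≡ j
  i+[j-i]≡j = solve-∀

x⊕[y⊖z]≡y⊕[x⊖z] : ∀ x y z → x ⊕ (y ⊖ z) ≡ y ⊕ (x ⊖ z)
x⊕[y⊖z]≡y⊕[x⊖z] (a , b) (c , d) (e , f) = cong₂ _,_ (swap a c e) (swap b d f)
  where
  swap : ∀ i j k → i + (j - k) ≡ j + (i - k)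
  swap = solve-∀

≼-by-difference : ∀ {x y} x' y' → x ≼ y → y' ⊖ x' ≡ y ⊖ x → x' ≼ y'
≼-by-difference {x} {y} x' y' x≼y eq =
  subst₂ _≼_ (x⊕[y⊖x]≡y x x') y⊕[x'⊖x]≡y' (≼-translate (x' ⊖ x) x≼y)
  where
  open ≡-Reasoning
  y⊕[x'⊖x]≡y' : y ⊕ (x' ⊖ x) ≡ y'
  y⊕[x'⊖x]≡y' = begin
    y ⊕ (x' ⊖ x)   ≡⟨ x⊕[y⊖z]≡y⊕[x⊖z] y x' x ⟩
    x' ⊕ (y ⊖ x)   ≡⟨ cong (x' ⊕_) (sym eq) ⟩
    x' ⊕ (y' ⊖ x') ≡⟨ x⊕[y⊖x]≡y x' y' ⟩
    y'             ∎

minL-monoʳ-≼ : ∀ c {x y} → x ≼ y → minL c x ≼ minL c y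
minL-monoʳ-≼ c {x} {y} x≼y with c ≼? x | c ≼? y
... | yes _   | yes _   = ≼-refl c
... | yes c≼x | no _    = ≼-trans c≼x x≼y
... | no c⋠x  | yes _   = ⋠⇒≽ c x c⋠x
... | no _    | no _    = x≼y

maxL-monoʳ-≼ : ∀ c {x y} → x ≼ y → maxL c x ≼ maxL c y
maxL-monoʳ-≼ c {x} {y} x≼y with c ≼? x | c ≼? y
... | yes _   | yes _   = x≼y
... | yes c≼x | no c⋠y  = ⊥-elim (c⋠y (≼-trans c≼x x≼y))
... | no _    | yes c≼y = c≼y
... | no _    | no _    = ≼-refl c

x≼maxL : ∀ x y → x ≼ maxL x y
x≼maxL x y with x ≼? y
... | yes x≼y = x≼y
... | no _    = ≼-refl x

y≼maxL : ∀ x y → y ≼ maxL x y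
y≼maxL x y with x ≼? y
... | yes _   = ≼-refl y
... | no x⋠y  = ⋠⇒≽ x y x⋠y

≼-minL⊕maxL : ∀ {q} c d e b → q ≼ (c ⊕ d) → q ≼ (e ⊕ b) → q ≼ (minL c e ⊕ maxL d b)
≼-minL⊕maxL c d e b q≼c⊕d q≼e⊕b with c ≼? e
... | yes _ = ≼-trans q≼c⊕d (⊕-monoʳ-≼ c (x≼maxL d b))
... | no _  = ≼-trans q≼e⊕b (⊕-monoʳ-≼ e (y≼maxL d b))

module _ (n p : ℕ) where

  private
    N : Pt
    N = N0 n p

    N-1 : Pt
    N-1 = (+ n - + 1 , + 0)

  ≤A-pos : ∀ {x y α β} → 0 < α → α ℕ.≤ β → x ≼ y → _≤A_ n p (x , α) (y , β)
  ≤A-pos 0<α α≤β x≼y = inj₁ (0<α , α≤β , x≼y)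

  ≤A-zero : ∀ {x y} → y ≼ x → _≤A_ n p (x , 0) (y , 0)
  ≤A-zero y≼x = inj₂ (inj₁ (refl , refl , y≼x))

  ≤A-zero-suc : ∀ {x y β} → N-1 ≼ (x ⊕ y) → _≤A_ n p (x , 0) (y , suc β)
  ≤A-zero-suc N-1≼x⊕y = inj₂ (inj₂ (refl , s≤s z≤n , N-1≼x⊕y))

  N-1≼N⊕0 : N-1 ≼ (N ⊕ (+ 0 , + 0))
  N-1≼N⊕0 = ≼-by-difference {x = + 0 , + 0} {y = + 1 , + 0} N-1 (N ⊕ (+ 0 , + 0))
    (inj₁ (ℤ.+<+ (s≤s z≤n))) (cong₂ _,_ (1-diff (+ n)) refl)
    where
    1-diff : ∀ i → (i + + 0) - (i - + 1) ≡ + 1 - + 0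
    1-diff = solve-∀

  point-ii : Pt → Pt → Pt
  point-ii (m , r) (k , s) = (+ 2 ℤ.* + n - (m + k + + 1) , - (r + s))

  point-iv : Pt → Pt → Pt
  point-iv (m , r) (k , s) = (m + k + + 1 , r + s)

  ⊙pos-monoʳ : ∀ u y z {γ δ} → γ ℕ.≤ δ → y ≼ z → _≤A_ n p (⊙pos n p u y γ) (⊙pos n p u z δ)
  ⊙pos-monoʳ u y z {suc _} {suc _} γ≤δ y≼z =
    ≤A-pos (s≤s z≤n) γ≤δ (maxL-monoʳ-≼ (+ 0 , + 0) (⊖-monoˡ-≼ N (⊕-monoʳ-≼ u y≼z)))
  ⊙pos-monoʳ u@(m , r) y@(k , s) z@(l , t) {zero} {suc _} _ y≼z =
    ≤A-zero-suc (≼-minL⊕maxL N (+ 0 , + 0) (point-ii u y) ((u ⊕ z) ⊖ N) N-1≼N⊕0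
      (≼-by-difference N-1 (point-ii u y ⊕ ((u ⊕ z) ⊖ N)) y≼z
        (cong₂ _,_ (fst (+ n) m k l) (snd r s t))))
    where
    fst : ∀ i m k l → ((+ 2 ℤ.* i - (m + k + + 1)) + ((m + l) - i)) - (i - + 1) ≡ l - k
    fst = solve-∀
    snd : ∀ r s t → (- (r + s) + ((r + t) - + 0)) - + 0 ≡ t - s
    snd = solve-∀
  ⊙pos-monoʳ u@(m , r) y@(k , s) z@(l , t) {zero} {zero} _ y≼z =
    ≤A-zero (minL-monoʳ-≼ N (≼-by-difference (point-ii u z) (point-ii u y) y≼z
      (cong₂ _,_ (fst (+ n) m k l) (snd r s t))))
    where
    fst : ∀ i m k l → (+ 2 ℤ.* i - (m + k + + 1)) - (+ 2 ℤ.* i - (m + l + + 1)) ≡ l - k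
    fst = solve-∀
    snd : ∀ r s t → - (r + s) - - (r + t) ≡ t - s
    snd = solve-∀

  →ω≤A⊙pos : ∀ u y z γ → N-1 ≼ (y ⊕ z) → _≤A_ n p (_→ω_ n p u y , 0) (⊙pos n p u z γ)
  →ω≤A⊙pos u@(m , r) y@(k , s) z@(l , t) zero N-1≼y⊕z =
    ≤A-zero (minL-monoʳ-≼ N (≼-by-difference (point-ii u z) ((N ⊖ u) ⊕ y) N-1≼y⊕z
      (cong₂ _,_ (fst (+ n) m k l) (snd r s t))))
    where
    fst : ∀ i m k l → ((i - m) + k) - (+ 2 ℤ.* i - (m + l + + 1)) ≡ (k + l) - (i - + 1)
    fst = solve-∀
    snd : ∀ r s t → ((+ 0 - r) + s) - - (r + t) ≡ (s + t) - + 0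
    snd = solve-∀
  →ω≤A⊙pos u@(m , r) y@(k , s) z@(l , t) (suc _) N-1≼y⊕z =
    ≤A-zero-suc (≼-minL⊕maxL N (+ 0 , + 0) ((N ⊖ u) ⊕ y) ((u ⊕ z) ⊖ N) N-1≼N⊕0
      (≼-by-difference N-1 (((N ⊖ u) ⊕ y) ⊕ ((u ⊕ z) ⊖ N)) N-1≼y⊕z
        (cong₂ _,_ (fst (+ n) m k l) (snd r s t))))
    where
    fst : ∀ i m k l → (((i - m) + k) + ((m + l) - i)) - (i - + 1) ≡ (k + l) - (i - + 1)
    fst = solve-∀
    snd : ∀ r s t → (((+ 0 - r) + s) + ((r + t) - + 0)) - + 0 ≡ (s + t) - + 0
    snd = solve-∀

  ⊙-monoʳ-≤A : ∀ a b c → _≤A_ n p b c → _≤A_ n p (_⊙_ n p a b) (_⊙_ n p a c)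
  ⊙-monoʳ-≤A (u , zero) (y , suc _) (z , suc _) (inj₁ (_ , _ , y≼z)) =
    ≤A-zero (minL-monoʳ-≼ N (≼-translate u (⊖-antiʳ-≼ N y≼z)))
  ⊙-monoʳ-≤A (u , suc α) (y , suc _) (z , suc _) (inj₁ (_ , β≤γ , y≼z)) =
    ⊙pos-monoʳ u y z (ℕP.∸-monoˡ-≤ p (ℕP.+-monoʳ-≤ (suc α) β≤γ)) y≼z
  ⊙-monoʳ-≤A (u@(m , r) , zero) (y@(k , s) , zero) (z@(l , t) , zero) (inj₂ (inj₁ (_ , _ , z≼y))) =
    ≤A-zero (minL-monoʳ-≼ N (≼-by-difference (point-iv u z) (point-iv u y) z≼y
      (cong₂ _,_ (fst m k l) (snd r s t))))
    where
    fst : ∀ m k l → (m + k + + 1) - (m + l + + 1) ≡ k - l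
    fst = solve-∀
    snd : ∀ r s t → (r + s) - (r + t) ≡ s - t
    snd = solve-∀
  ⊙-monoʳ-≤A (u , suc _) (y , zero) (z , zero) (inj₂ (inj₁ (_ , _ , z≼y))) =
    ≤A-zero (minL-monoʳ-≼ N (⊕-monoʳ-≼ (N ⊖ u) z≼y))
  ⊙-monoʳ-≤A (u@(m , r) , zero) (y@(k , s) , zero) (z@(l , t) , suc _) (inj₂ (inj₂ (_ , _ , N-1≼y⊕z))) =
    ≤A-zero (minL-monoʳ-≼ N (≼-by-difference ((N ⊖ z) ⊕ u) (point-iv u y) N-1≼y⊕z
      (cong₂ _,_ (fst (+ n) m k l) (snd r s t))))
    where
    fst : ∀ i m k l → (m + k + + 1) - ((i - l) + m) ≡ (k + l) - (i - + 1)
    fst = solve-∀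
    snd : ∀ r s t → (r + s) - ((+ 0 - t) + r) ≡ (s + t) - + 0
    snd = solve-∀
  ⊙-monoʳ-≤A (u , suc α) (y , zero) (z , suc γ) (inj₂ (inj₂ (_ , _ , N-1≼y⊕z))) =
    →ω≤A⊙pos u y z (_*p_ n p (suc α) (suc γ)) N-1≼y⊕z
  ⊙-monoʳ-≤A _ (_ , suc _) _ (inj₂ (inj₁ (() , _)))
  ⊙-monoʳ-≤A _ (_ , suc _) _ (inj₂ (inj₂ (() , _)))

lemma2p2 : (n p : ℕ) → 0 < n → 0 < p →
    (a b c : Elem n p) → InA n p a → InA n p b → InA n p c →
    _≤A_ n p b c → _≤A_ n p (_⊙_ n p a b) (_⊙_ n p a c)
lemma2p2 n p _ _ a b c _ _ _ = ⊙-monoʳ-≤A n p a b c
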